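{- Let $(G,k)$ be a reduced instance of \textsc{Trivially Perfect Editing}. Suppose $M\subseteq V(G)$ is a module such that $G[M]$ is trivially perfect and contains an independent set of size at least $2k+5$, and let $I\subseteq M$ be any independent set of size $2k+4$. Then $(G,k)$ is a yes-instance if and only if $(G-(M\setminus I),k)$ is a yes-instance.
   Context: Graphs are finite, simple, undirected; a graph is trivially perfect if it has no induced $C_4$ or $P_4$. \textsc{Trivially Perfect Editing}: given $(G,k)$, decide if some $S\subseteq\binom{V(G)}{2}$, $|S|\le k$, makes $(V(G),E(G)\triangle S)$ trivially perfect. The instance $(G,k)$ is reduced if neither of the following holds: (i) there is a non-edge $uv$ such that the complement of $G[N(u)\cap N(v)]$ has a matching of size $\ge k+1$; (ii) there is an edge $uv$ and $k+1$ pairwise disjoint non-adjacent pairs $\{a,b\}$ with $a\in N(u)\setminus N[v]$, $b\in N(v)\setminus N[u]$. A module is a set $M\subseteq V(G)$ such that $N(u)\setminus M=N(v)\setminus M$ for all $u,v\in M$. -}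

module Defs where

open import Data.Nat using (ℕ; suc; _≤_)
open import Data.Fin using (Fin)
open import Data.Fin.Subset using (Subset; _∈_; _∉_; _⊆_; ∣_∣; _─_; ∁)
open import Data.List using (List; []; _∷_; length)
open import Data.List.Membership.Propositional using () renaming (_∈_ to _∈ₗ_)
open import Data.List.Relation.Unary.All using (All)
open import Data.List.Relation.Unary.Unique.Propositional using (Unique)
open import Data.Product using (Σ; ∃; _×_; _,_; proj₁; proj₂)
open import Data.Sum using (_⊎_)
open import Relation.Nullary using (¬_; Dec)
open import Relation.Binary.PropositionalEquality using (_≡_; _≢_)

record Graph (V : Set) : Set₁ where
  field
    E     : V → V → Set
    E-sym : ∀ {u v} → E u v → E v u
    E-irr : ∀ {v} → ¬ E v v
    E-dec : ∀ u v → Dec (E u v)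
open Graph public

Rel : Set → Set₁
Rel V = V → V → Set

InducedP4 : {V : Set} → Rel V → V → V → V → V → Set
InducedP4 R a b c d =
  R a b × R b c × R c d × ¬ R a c × ¬ R b d × ¬ R a d

InducedC4 : {V : Set} → Rel V → V → V → V → V → Set
InducedC4 R a b c d =
  R a b × R b c × R c d × R d a × ¬ R a c × ¬ R b d

TriviallyPerfect : {V : Set} → Rel V → Set
TriviallyPerfect R = ∀ a b c d →
  a ≢ b → a ≢ c → a ≢ d → b ≢ c → b ≢ d → c ≢ d →
  ¬ InducedP4 R a b c d × ¬ InducedC4 R a b c d

-- an edit set is a list of vertex pairs (each with distinct endpoints);
-- {u,v} ∈ S iff (u,v) or (v,u) occurs in the list
InS : {V : Set} → List (V × V) → V → V → Set
InS S u v = (u , v) ∈ₗ S ⊎ (v , u) ∈ₗ S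

Edit : {V : Set} → Rel V → List (V × V) → Rel V
Edit R S u v = (R u v × ¬ InS S u v) ⊎ (¬ R u v × InS S u v)

YesInstance : {V : Set} → Rel V → ℕ → Set
YesInstance {V} R k = Σ (List (V × V)) λ S →
  length S ≤ k × All (λ p → proj₁ p ≢ proj₂ p) S × TriviallyPerfect (Edit R S)

-- list of all endpoints of a list of pairs (used to express pairwise disjointness)
ends : {V : Set} → List (V × V) → List V
ends [] = []
ends ((a , b) ∷ L) = a ∷ b ∷ ends L

-- Reduction rule (i) applies: a non-edge uv such that the complement of
-- G[N(u) ∩ N(v)] has a matching of size ≥ k+1
Rule1Applies : {V : Set} → Graph V → ℕ → Set
Rule1Applies {V} G k = Σ V λ u → Σ V λ v → u ≢ v × ¬ E G u v ×
  Σ (List (V × V)) λ L → suc k ≤ length L × Unique (ends L) ×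
    All (λ p → (E G u (proj₁ p) × E G v (proj₁ p)) ×
               (E G u (proj₂ p) × E G v (proj₂ p)) ×
               ¬ E G (proj₁ p) (proj₂ p)) L

Rule2Applies : {V : Set} → Graph V → ℕ → Set
Rule2Applies {V} G k = Σ V λ u → Σ V λ v → E G u v ×
  Σ (List (V × V)) λ L → length L ≡ suc k × Unique (ends L) ×
    All (λ p → (E G u (proj₁ p) × ¬ E G v (proj₁ p) × proj₁ p ≢ v) ×
               (E G v (proj₂ p) × ¬ E G u (proj₂ p) × proj₂ p ≢ u) ×
               ¬ E G (proj₁ p) (proj₂ p)) L

Reduced : {V : Set} → Graph V → ℕ → Set
Reduced G k = ¬ Rule1Applies G k × ¬ Rule2Applies G k

IsModule : {n : ℕ} → Graph (Fin n) → Subset n → Set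
IsModule G M = ∀ u v w → u ∈ M → v ∈ M → w ∉ M →
  (E G u w → E G v w) × (E G v w → E G u w)

Independent : {n : ℕ} → Graph (Fin n) → Subset n → Set
Independent G J = ∀ u v → u ∈ J → v ∈ J → ¬ E G u v

Induced : {n : ℕ} → Graph (Fin n) → (X : Subset n) → Rel (Σ (Fin n) λ v → v ∈ X)
Induced G X x y = E G (proj₁ x) (proj₁ y)

-- Restricting a solution of G to G − (M ∖ I) gives a solution there, since trivially perfect graphs
-- are closed under induced subgraphs. Conversely, a solution S′ of G − (M ∖ I) with |S′| ≤ k touches
-- at most 2k vertices, so two vertices x₁, x₂ of the independent set I are untouched. Keep the pairs
-- of S′ that avoid M and let H be the edited graph. Then M is still a module of H, H[M] = G[M] is
-- trivially perfect, and on (V ∖ M) ∪ {x₁, x₂} the graph H agrees with G − (M ∖ I) edited by S′.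
-- An induced P₄ or C₄ of H meeting M at most once survives when its vertex in M is replaced by x₁.
-- One meeting M two or three times has a nontrivial module, which in a P₄ or C₄ can only be a pair
-- of opposite vertices of a C₄; sending that pair to the nonadjacent twins x₁, x₂ gives a C₄ again.
module Submission where

open import Defs
open import Data.Nat using (ℕ; suc; _≤_; _<_; _+_; _*_; s≤s)
open import Data.Nat.Properties
  using ( ≤-reflexive; ≤-trans; <-trans; n≤1+n; n<1+n; <⇒≱; *-suc; +-comm; +-monoʳ-≤; *-monoʳ-≤; m≤m+n
        ; module ≤-Reasoning)
open import Data.Fin using (Fin; zero; suc; _≟_)
open import Data.Fin.Subset
  using (Subset; _∈_; _∉_; _⊆_; ∣_∣; _─_; _-_; ∁; ⁅_⁆; inside; outside) renaming (⊥ to ∅)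
open import Data.Fin.Subset.Properties
  using (_∈?_; p─⊥≡p; ∣⊥∣≡0; p⊆q⇒∣p∣≤∣q∣; p─q⊆p; x∈⁅x⁆; x∉p⇒x∈∁p)
open import Data.Fin.Properties using (any?)
open import Data.Vec.Base as Vec using (_∷_)
open import Data.Vec.Properties.WithK using ([]=-irrelevant)
open import Data.Maybe using (Maybe; just; nothing; zip)
open import Data.List using (List; []; _∷_; length; map; mapMaybe)
open import Data.List.Properties using (length-map; length-mapMaybe)
open import Data.List.Relation.Unary.Any using (here; there)
open import Data.List.Relation.Unary.All as All using (All)
open import Data.List.Membership.Propositional using () renaming (_∈_ to _∈ₗ_; _∉_ to _∉ₗ_)
open import Data.List.Membership.Propositional.Properties using (∈-map⁺)
import Data.List.Membership.DecPropositional as DecMembership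
open import Data.Product as Prod using (Σ; ∃; ∃₂; _×_; _,_; proj₁; proj₂)
open import Data.Sum as Sum using (_⊎_; inj₁; inj₂; [_,_]′)
open import Data.Unit using (⊤; tt)
open import Data.Empty using (⊥; ⊥-elim)
open import Function using (_∘_; case_of_)
open import Function.Bundles using (_⇔_; mk⇔; Equivalence)
open import Function.Construct.Identity using (⇔-id)
open import Function.Construct.Composition using (_⇔-∘_)
open import Function.Construct.Symmetry using (⇔-sym)
open import Relation.Nullary using (¬_; yes; no; contradiction)
open import Relation.Nullary.Decidable using (_×-dec_; ¬?; decidable-stable)
open import Relation.Unary using (Decidable)
open import Relation.Binary using (Symmetric)
open import Relation.Binary.PropositionalEquality using (_≡_; _≢_; refl; sym; trans; cong; cong₂; subst₂)

x∈q⇒x∉p─q : ∀ {n} {x : Fin n} (p q : Subset n) → x ∈ q → x ∉ p ─ q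
x∈q⇒x∉p─q (_ ∷ p) (inside ∷ q) Vec.here ()
x∈q⇒x∉p─q (_ ∷ p) (_ ∷ q) (Vec.there x∈q) (Vec.there x∈p─q) = x∈q⇒x∉p─q p q x∈q x∈p─q

∣p∣≤1+∣p-x∣ : ∀ {n} (p : Subset n) x → ∣ p ∣ ≤ suc ∣ p - x ∣
∣p∣≤1+∣p-x∣ (inside  ∷ p) zero    = s≤s (≤-reflexive (cong ∣_∣ (sym (p─⊥≡p p))))
∣p∣≤1+∣p-x∣ (outside ∷ p) zero    = ≤-trans (≤-reflexive (cong ∣_∣ (sym (p─⊥≡p p)))) (n≤1+n _)
∣p∣≤1+∣p-x∣ (inside  ∷ p) (suc x) = s≤s (∣p∣≤1+∣p-x∣ p x)
∣p∣≤1+∣p-x∣ (outside ∷ p) (suc x) = ∣p∣≤1+∣p-x∣ p x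

∣p∣≤length : ∀ {n} (p : Subset n) (xs : List (Fin n)) → (∀ {t} → t ∈ p → t ∈ₗ xs) → ∣ p ∣ ≤ length xs
∣p∣≤length {n} p [] p⊆[] =
  ≤-trans (p⊆q⇒∣p∣≤∣q∣ {q = ∅} (λ t∈p → case p⊆[] t∈p of λ ())) (≤-reflexive (∣⊥∣≡0 n))
∣p∣≤length p (x ∷ xs) p⊆x∷xs = ≤-trans (∣p∣≤1+∣p-x∣ p x) (s≤s (∣p∣≤length (p - x) xs p-x⊆xs))
  where
  p-x⊆xs : ∀ {t} → t ∈ p - x → t ∈ₗ xs
  p-x⊆xs t∈p-x with p⊆x∷xs (p─q⊆p p ⁅ x ⁆ t∈p-x)
  ... | here refl  = ⊥-elim (x∈q⇒x∉p─q p ⁅ x ⁆ (x∈⁅x⁆ x) t∈p-x)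
  ... | there t∈xs = t∈xs

module _ {n : ℕ} where
  open DecMembership (_≟_ {n}) using () renaming (_∈?_ to _∈ₗ?_)

  fresh : (p : Subset n) (xs : List (Fin n)) → length xs < ∣ p ∣ → ∃ λ t → t ∈ p × t ∉ₗ xs
  fresh p xs |xs|<∣p∣ with any? (λ t → t ∈? p ×-dec ¬? (t ∈ₗ? xs))
  ... | yes (t , t∈p , t∉xs) = t , t∈p , t∉xs
  ... | no ∄ = ⊥-elim (<⇒≱ |xs|<∣p∣ (∣p∣≤length p xs λ {t} t∈p →
                 decidable-stable (t ∈ₗ? xs) (λ t∉xs → ∄ (t , t∈p , t∉xs))))

  fresh₂ : (p : Subset n) (xs : List (Fin n)) → suc (length xs) < ∣ p ∣ →
    ∃₂ λ t₁ t₂ → t₁ ∈ p × t₂ ∈ p × t₁ ≢ t₂ × t₁ ∉ₗ xs × t₂ ∉ₗ xs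
  fresh₂ p xs 1+|xs|<∣p∣ =
    let t₁ , t₁∈p , t₁∉xs   = fresh p xs (<-trans (n<1+n (length xs)) 1+|xs|<∣p∣)
        t₂ , t₂∈p , t₂∉t₁xs = fresh p (t₁ ∷ xs) 1+|xs|<∣p∣
    in t₁ , t₂ , t₁∈p , t₂∈p , (λ t₁≡t₂ → t₂∉t₁xs (here (sym t₁≡t₂))) , t₁∉xs , t₂∉t₁xs ∘ there

subset-ext : ∀ {n} {p : Subset n} {a b : Σ (Fin n) (_∈ p)} → proj₁ a ≡ proj₁ b → a ≡ b
subset-ext {a = u , _} {b = .u , _} refl = cong (u ,_) ([]=-irrelevant _ _)

module _ {A B : Set} {f : A → Maybe B} where

  ∈-mapMaybe⁺ : ∀ xs {x y} → x ∈ₗ xs → f x ≡ just y → y ∈ₗ mapMaybe f xs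
  ∈-mapMaybe⁺ (x ∷ xs) (here refl) fx≡y rewrite fx≡y = here refl
  ∈-mapMaybe⁺ (z ∷ xs) (there x∈xs) fx≡y with f z
  ... | nothing = ∈-mapMaybe⁺ xs x∈xs fx≡y
  ... | just _  = there (∈-mapMaybe⁺ xs x∈xs fx≡y)

  ∈-mapMaybe⁻ : ∀ xs {y} → y ∈ₗ mapMaybe f xs → ∃ λ x → x ∈ₗ xs × f x ≡ just y
  ∈-mapMaybe⁻ (x ∷ xs) y∈ with f x in fx≡
  ... | nothing = Prod.map₂ (Prod.map₁ there) (∈-mapMaybe⁻ xs y∈)
  ... | just _ with y∈
  ...   | here refl = x , here refl , fx≡
  ...   | there y∈′ = Prod.map₂ (Prod.map₁ there) (∈-mapMaybe⁻ xs y∈′)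

zip-just : ∀ {A B : Set} {m₁ : Maybe A} {m₂ : Maybe B} {y₁ y₂} →
  zip m₁ m₂ ≡ just (y₁ , y₂) → m₁ ≡ just y₁ × m₂ ≡ just y₂
zip-just {m₁ = just _}  {just _}  refl = refl , refl
zip-just {m₁ = just _}  {nothing} ()
zip-just {m₁ = nothing}           ()

mapPairs : {A B : Set} → (A → Maybe B) → List (A × A) → List (B × B)
mapPairs f = mapMaybe λ (x , y) → zip (f x) (f y)

Loopless : {V : Set} → V × V → Set
Loopless (u , v) = u ≢ v

Untouched : {V : Set} → List (V × V) → V → Set
Untouched S u = ∀ v → ¬ InS S u v

module _ {A B : Set} (f : A → Maybe B) (S : List (A × A)) where

  ∈-mapPairs⁺ : ∀ {x₁ x₂ y₁ y₂} → (x₁ , x₂) ∈ₗ S → f x₁ ≡ just y₁ → f x₂ ≡ just y₂ →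
    (y₁ , y₂) ∈ₗ mapPairs f S
  ∈-mapPairs⁺ x∈S fx₁≡ fx₂≡ = ∈-mapMaybe⁺ S x∈S (cong₂ zip fx₁≡ fx₂≡)

  ∈-mapPairs⁻ : ∀ {y₁ y₂} → (y₁ , y₂) ∈ₗ mapPairs f S →
    ∃₂ λ x₁ x₂ → (x₁ , x₂) ∈ₗ S × f x₁ ≡ just y₁ × f x₂ ≡ just y₂
  ∈-mapPairs⁻ y∈ with (x₁ , x₂) , x∈S , fx≡ ← ∈-mapMaybe⁻ S y∈ = x₁ , x₂ , x∈S , zip-just fx≡

  InS-mapPairs⁺ : ∀ {x₁ x₂ y₁ y₂} → InS S x₁ x₂ → f x₁ ≡ just y₁ → f x₂ ≡ just y₂ →
    InS (mapPairs f S) y₁ y₂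
  InS-mapPairs⁺ (inj₁ x∈S) fx₁≡ fx₂≡ = inj₁ (∈-mapPairs⁺ x∈S fx₁≡ fx₂≡)
  InS-mapPairs⁺ (inj₂ x∈S) fx₁≡ fx₂≡ = inj₂ (∈-mapPairs⁺ x∈S fx₂≡ fx₁≡)

  InS-mapPairs⁻ : ∀ {y₁ y₂} → InS (mapPairs f S) y₁ y₂ →
    ∃₂ λ x₁ x₂ → InS S x₁ x₂ × f x₁ ≡ just y₁ × f x₂ ≡ just y₂
  InS-mapPairs⁻ (inj₁ y∈) with x₁ , x₂ , x∈S , fx₁≡ , fx₂≡ ← ∈-mapPairs⁻ y∈ = x₁ , x₂ , inj₁ x∈S , fx₁≡ , fx₂≡
  InS-mapPairs⁻ (inj₂ y∈) with x₂ , x₁ , x∈S , fx₂≡ , fx₁≡ ← ∈-mapPairs⁻ y∈ = x₁ , x₂ , inj₂ x∈S , fx₁≡ , fx₂≡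

  mapPairs-loopless : (∀ {x x′ y} → f x ≡ just y → f x′ ≡ just y → x ≡ x′) →
    All Loopless S → All Loopless (mapPairs f S)
  mapPairs-loopless f-injective loopless = All.tabulate λ y∈ y₁≡y₂ →
    let _ , _ , x∈S , fx₁≡ , fx₂≡ = ∈-mapPairs⁻ y∈
    in All.lookup loopless x∈S (f-injective fx₁≡ (trans fx₂≡ (cong just (sym y₁≡y₂))))

module _ {A : Set} where

  length-ends : (S : List (A × A)) → length (ends S) ≡ 2 * length S
  length-ends []      = refl
  length-ends (_ ∷ S) = trans (cong (2 +_) (length-ends S)) (sym (*-suc 2 (length S)))

  ∈⇒∈-ends : ∀ (S : List (A × A)) {x y} → (x , y) ∈ₗ S → x ∈ₗ ends S × y ∈ₗ ends S
  ∈⇒∈-ends (_ ∷ _) (here refl)  = here refl , there (here refl)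
  ∈⇒∈-ends (_ ∷ S) (there p∈S) = Prod.map (there ∘ there) (there ∘ there) (∈⇒∈-ends S p∈S)

  InS⇒∈-ends : ∀ {S : List (A × A)} {x y} → InS S x y → x ∈ₗ ends S
  InS⇒∈-ends {S} (inj₁ p∈S) = proj₁ (∈⇒∈-ends S p∈S)
  InS⇒∈-ends {S} (inj₂ p∈S) = proj₂ (∈⇒∈-ends S p∈S)

  InS-sym : ∀ {S : List (A × A)} {u v} → InS S u v → InS S v u
  InS-sym = [ inj₂ , inj₁ ]′

  module _ {R : Rel A} {S : List (A × A)} where

    Edit-sym : Symmetric R → Symmetric (Edit R S)
    Edit-sym R-sym = [ inj₁ ∘ Prod.map R-sym (_∘ InS-sym) , inj₂ ∘ Prod.map (_∘ R-sym) InS-sym ]′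

    Edit-unedited : ∀ {u v} → ¬ InS S u v → Edit R S u v ⇔ R u v
    Edit-unedited ¬i = mk⇔ [ proj₁ , (λ (_ , i) → ⊥-elim (¬i i)) ]′ (λ r → inj₁ (r , ¬i))

Edit-cong : ∀ {A B : Set} {R : Rel A} {R′ : Rel B} {S : List (A × A)} {S′ : List (B × B)} {u v u′ v′} →
  R u v ⇔ R′ u′ v′ → InS S u v ⇔ InS S′ u′ v′ → Edit R S u v ⇔ Edit R′ S′ u′ v′
Edit-cong r i = mk⇔ (Sum.map (Prod.map (to r) (_∘ from i)) (Prod.map (_∘ from r) (to i)))
                    (Sum.map (Prod.map (from r) (_∘ to i)) (Prod.map (_∘ to r) (from i)))
  where open Equivalence

Free : {V : Set} → Rel V → V → V → V → V → Set
Free R a b c d = ¬ InducedP4 R a b c d × ¬ InducedC4 R a b c d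

AllPairs : {V : Set} → Rel V → V → V → V → V → Set
AllPairs _~_ a b c d = a ~ b × a ~ c × a ~ d × b ~ c × b ~ d × c ~ d

-- Pointwise rather than on Σ V P, where two witnesses of P for one vertex would count as distinct.
TriviallyPerfectOn : {V : Set} → (V → Set) → Rel V → Set
TriviallyPerfectOn P R = ∀ a b c d → P a → P b → P c → P d → AllPairs _≢_ a b c d → Free R a b c d

module _ {A B : Set} {R : Rel A} {R′ : Rel B} (R-sym : Symmetric R) (R′-sym : Symmetric R′) where
  open Equivalence

  Free-transport : ∀ {a b c d a′ b′ c′ d′} →
    R a b ⇔ R′ a′ b′ → R a c ⇔ R′ a′ c′ → R a d ⇔ R′ a′ d′ →
    R b c ⇔ R′ b′ c′ → R b d ⇔ R′ b′ d′ → R c d ⇔ R′ c′ d′ →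
    Free R′ a′ b′ c′ d′ → Free R a b c d
  Free-transport ab ac ad bc bd cd (¬P4′ , ¬C4′) =
    (λ (x , y , z , ¬u , ¬v , ¬w) →
       ¬P4′ (to ab x , to bc y , to cd z , ¬u ∘ from ac , ¬v ∘ from bd , ¬w ∘ from ad)) ,
    (λ (x , y , z , w , ¬u , ¬v) →
       ¬C4′ (to ab x , to bc y , to cd z , R′-sym (to ad (R-sym w)) , ¬u ∘ from ac , ¬v ∘ from bd))

  TriviallyPerfectOn-transfer : {P : A → Set} (f : ∀ {x} → P x → B) →
    (∀ {x y} (p : P x) (q : P y) → f p ≡ f q → x ≡ y) →
    (∀ {x y} (p : P x) (q : P y) → R x y ⇔ R′ (f p) (f q)) →
    TriviallyPerfect R′ → TriviallyPerfectOn P R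
  TriviallyPerfectOn-transfer f inj pres tp _ _ _ _ pa pb pc pd (a≢b , a≢c , a≢d , b≢c , b≢d , c≢d) =
    Free-transport (pres pa pb) (pres pa pc) (pres pa pd) (pres pb pc) (pres pb pd) (pres pc pd)
      (tp (f pa) (f pb) (f pc) (f pd) (a≢b ∘ inj pa pb) (a≢c ∘ inj pa pc) (a≢d ∘ inj pa pd)
          (b≢c ∘ inj pb pc) (b≢d ∘ inj pb pd) (c≢d ∘ inj pc pd))

  TriviallyPerfect-pullback : (f : A → B) → (∀ {x y} → f x ≡ f y → x ≡ y) →
    (∀ x y → R x y ⇔ R′ (f x) (f y)) → TriviallyPerfect R′ → TriviallyPerfect R
  TriviallyPerfect-pullback f inj pres tp a b c d a≢b a≢c a≢d b≢c b≢d c≢d =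
    TriviallyPerfectOn-transfer {P = λ _ → ⊤} (λ {x} _ → f x) (λ _ _ → inj) (λ {x} {y} _ _ → pres x y) tp
      a b c d tt tt tt tt (a≢b , a≢c , a≢d , b≢c , b≢d , c≢d)

module _ {V : Set} {R : Rel V} (R-sym : Symmetric R)
         {M : V → Set} (M? : Decidable M)
         (isModule : ∀ {u v w} → M u → M v → ¬ M w → R u w → R v w)
         {Q : V → Set} (¬M⇒Q : ∀ {v} → ¬ M v → Q v)
         {x₁ x₂ : V} (Mx₁ : M x₁) (Mx₂ : M x₂) (Qx₁ : Q x₁) (Qx₂ : Q x₂)
         (x₁≢x₂ : x₁ ≢ x₂) (¬Rx₁x₂ : ¬ R x₁ x₂)
         (tpM : TriviallyPerfectOn M R) (tpQ : TriviallyPerfectOn Q R) where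
  private
    R-sym-⇔ : ∀ {u v} → R u v ⇔ R v u
    R-sym-⇔ = mk⇔ R-sym R-sym

    module-⇔ : ∀ {u v w} → M u → M v → ¬ M w → R u w ⇔ R v w
    module-⇔ Mu Mv ¬Mw = mk⇔ (isModule Mu Mv ¬Mw) (isModule Mv Mu ¬Mw)

    inside≢outside : ∀ {u v} → M u → ¬ M v → u ≢ v
    inside≢outside Mu ¬Mv refl = ¬Mv Mu

    NotBoth : V → V → Set
    NotBoth u v = ¬ M u ⊎ ¬ M v

    collapse : V → V
    collapse v with M? v
    ... | yes _ = x₁
    ... | no  _ = v

    collapse-Q : ∀ v → Q (collapse v)
    collapse-Q v with M? v
    ... | yes _   = Qx₁
    ... | no  ¬Mv = ¬M⇒Q ¬Mv

    collapse-≢ : ∀ {u v} → NotBoth u v → u ≢ v → collapse u ≢ collapse v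
    collapse-≢ {u} {v} nb u≢v with M? u | M? v
    ... | yes Mu  | yes Mv  = [ contradiction Mu , contradiction Mv ]′ nb
    ... | yes _   | no  ¬Mv = inside≢outside Mx₁ ¬Mv
    ... | no  ¬Mu | yes _   = inside≢outside Mx₁ ¬Mu ∘ sym
    ... | no  _   | no  _   = u≢v

    collapse-⇔ : ∀ {u v} → NotBoth u v → R u v ⇔ R (collapse u) (collapse v)
    collapse-⇔ {u} {v} nb with M? u | M? v
    ... | yes Mu  | yes Mv  = [ contradiction Mu , contradiction Mv ]′ nb
    ... | yes Mu  | no  ¬Mv = module-⇔ Mu Mx₁ ¬Mv
    ... | no  ¬Mu | yes Mv  = R-sym-⇔ ⇔-∘ (module-⇔ Mv Mx₁ ¬Mu ⇔-∘ R-sym-⇔)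
    ... | no  _   | no  _   = ⇔-id _

    free-atMostOneInModule : ∀ {a b c d} → AllPairs NotBoth a b c d → AllPairs _≢_ a b c d → Free R a b c d
    free-atMostOneInModule {a} {b} {c} {d} (ab , ac , ad , bc , bd , cd) (a≢b , a≢c , a≢d , b≢c , b≢d , c≢d) =
      Free-transport {R = R} {R′ = R} R-sym R-sym
        (collapse-⇔ ab) (collapse-⇔ ac) (collapse-⇔ ad) (collapse-⇔ bc) (collapse-⇔ bd) (collapse-⇔ cd)
        (tpQ (collapse a) (collapse b) (collapse c) (collapse d)
             (collapse-Q a) (collapse-Q b) (collapse-Q c) (collapse-Q d)
             (collapse-≢ ab a≢b , collapse-≢ ac a≢c , collapse-≢ ad a≢d ,
              collapse-≢ bc b≢c , collapse-≢ bd b≢d , collapse-≢ cd c≢d))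

    noOppositeC4 : ∀ {a b c d} → M a → M c → ¬ M b → ¬ M d → b ≢ d → ¬ InducedC4 R a b c d
    noOppositeC4 Ma Mc ¬Mb ¬Md b≢d (ab , bc , cd , da , _ , ¬bd) =
      proj₂ (tpQ x₁ _ x₂ _ Qx₁ (¬M⇒Q ¬Mb) Qx₂ (¬M⇒Q ¬Md)
                 (inside≢outside Mx₁ ¬Mb , x₁≢x₂ , inside≢outside Mx₁ ¬Md ,
                  inside≢outside Mx₂ ¬Mb ∘ sym , b≢d , inside≢outside Mx₂ ¬Md))
        (isModule Ma Mx₁ ¬Mb ab , R-sym (isModule Mc Mx₂ ¬Mb (R-sym bc)) ,
         isModule Mc Mx₂ ¬Md cd , R-sym (isModule Ma Mx₁ ¬Md (R-sym da)) , ¬Rx₁x₂ , ¬bd)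

    separated : ∀ {u v w} → M u → M v → ¬ M w → R u w → ¬ R v w → ⊥
    separated Mu Mv ¬Mw uw ¬vw = ¬vw (isModule Mu Mv ¬Mw uw)

    noP4 : ∀ {a b c d} → AllPairs _≢_ a b c d → ¬ InducedP4 R a b c d
    noP4 {a} {b} {c} {d} ≢ p4@(ab , bc , cd , ¬ac , ¬bd , ¬ad) with M? a | M? b | M? c | M? d
    ... | yes Ma  | yes Mb  | yes Mc  | yes Md  = proj₁ (tpM a b c d Ma Mb Mc Md ≢) p4
    ... | yes Ma  | yes _   | yes Mc  | no  ¬Md = separated Mc Ma ¬Md cd ¬ad
    ... | yes Ma  | yes Mb  | no  ¬Mc | _       = separated Mb Ma ¬Mc bc ¬ac
    ... | yes Ma  | no  ¬Mb | _       | yes Md  = separated Ma Md ¬Mb ab (¬bd ∘ R-sym)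
    ... | yes Ma  | no  _   | yes Mc  | no  ¬Md = separated Mc Ma ¬Md cd ¬ad
    ... | yes _   | no  ¬Mb | no  ¬Mc | no  ¬Md =
      proj₁ (free-atMostOneInModule (inj₂ ¬Mb , inj₂ ¬Mc , inj₂ ¬Md , inj₁ ¬Mb , inj₁ ¬Mb , inj₁ ¬Mc) ≢) p4
    ... | no  ¬Ma | yes Mb  | yes Mc  | _       = separated Mb Mc ¬Ma (R-sym ab) (¬ac ∘ R-sym)
    ... | no  ¬Ma | yes Mb  | no  _   | yes Md  = separated Mb Md ¬Ma (R-sym ab) (¬ad ∘ R-sym)
    ... | no  ¬Ma | no  ¬Mb | yes Mc  | yes Md  = separated Mc Md ¬Mb (R-sym bc) (¬bd ∘ R-sym)
    ... | no  ¬Ma | yes _   | no  ¬Mc | no  ¬Md =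
      proj₁ (free-atMostOneInModule (inj₁ ¬Ma , inj₁ ¬Ma , inj₁ ¬Ma , inj₂ ¬Mc , inj₂ ¬Md , inj₁ ¬Mc) ≢) p4
    ... | no  ¬Ma | no  ¬Mb | _       | no  ¬Md =
      proj₁ (free-atMostOneInModule (inj₁ ¬Ma , inj₁ ¬Ma , inj₁ ¬Ma , inj₁ ¬Mb , inj₁ ¬Mb , inj₂ ¬Md) ≢) p4
    ... | no  ¬Ma | no  ¬Mb | no  ¬Mc | yes _   =
      proj₁ (free-atMostOneInModule (inj₁ ¬Ma , inj₁ ¬Ma , inj₁ ¬Ma , inj₁ ¬Mb , inj₁ ¬Mb , inj₁ ¬Mc) ≢) p4

    noC4 : ∀ {a b c d} → AllPairs _≢_ a b c d → ¬ InducedC4 R a b c d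
    noC4 {a} {b} {c} {d} ≢@(_ , a≢c , _ , _ , b≢d , _) c4@(ab , bc , cd , da , ¬ac , ¬bd)
      with M? a | M? b | M? c | M? d
    ... | yes Ma  | yes Mb  | yes Mc  | yes Md  = proj₂ (tpM a b c d Ma Mb Mc Md ≢) c4
    ... | yes Ma  | yes Mb  | yes _   | no  ¬Md = separated Ma Mb ¬Md (R-sym da) ¬bd
    ... | yes Ma  | yes Mb  | no  ¬Mc | _       = separated Mb Ma ¬Mc bc ¬ac
    ... | yes Ma  | no  ¬Mb | _       | yes Md  = separated Ma Md ¬Mb ab (¬bd ∘ R-sym)
    ... | yes Ma  | no  ¬Mb | yes Mc  | no  ¬Md = noOppositeC4 Ma Mc ¬Mb ¬Md b≢d c4
    ... | yes _   | no  ¬Mb | no  ¬Mc | no  ¬Md =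
      proj₂ (free-atMostOneInModule (inj₂ ¬Mb , inj₂ ¬Mc , inj₂ ¬Md , inj₁ ¬Mb , inj₁ ¬Mb , inj₁ ¬Mc) ≢) c4
    ... | no  ¬Ma | yes Mb  | yes Mc  | _       = separated Mb Mc ¬Ma (R-sym ab) (¬ac ∘ R-sym)
    ... | no  ¬Ma | yes Mb  | no  ¬Mc | yes Md  =
      noOppositeC4 Mb Md ¬Mc ¬Ma (a≢c ∘ sym) (bc , cd , da , ab , ¬bd , ¬ac ∘ R-sym)
    ... | no  ¬Ma | no  _   | yes Mc  | yes Md  = separated Md Mc ¬Ma da (¬ac ∘ R-sym)
    ... | no  ¬Ma | yes _   | no  ¬Mc | no  ¬Md =
      proj₂ (free-atMostOneInModule (inj₁ ¬Ma , inj₁ ¬Ma , inj₁ ¬Ma , inj₂ ¬Mc , inj₂ ¬Md , inj₁ ¬Mc) ≢) c4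
    ... | no  ¬Ma | no  ¬Mb | _       | no  ¬Md =
      proj₂ (free-atMostOneInModule (inj₁ ¬Ma , inj₁ ¬Ma , inj₁ ¬Ma , inj₁ ¬Mb , inj₁ ¬Mb , inj₂ ¬Md) ≢) c4
    ... | no  ¬Ma | no  ¬Mb | no  ¬Mc | yes _   =
      proj₂ (free-atMostOneInModule (inj₁ ¬Ma , inj₁ ¬Ma , inj₁ ¬Ma , inj₁ ¬Mb , inj₁ ¬Mb , inj₁ ¬Mc) ≢) c4

  TriviallyPerfect-fromModule : TriviallyPerfect R
  TriviallyPerfect-fromModule a b c d a≢b a≢c a≢d b≢c b≢d c≢d =
    noP4 (a≢b , a≢c , a≢d , b≢c , b≢d , c≢d) , noC4 (a≢b , a≢c , a≢d , b≢c , b≢d , c≢d)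

module Reduction {n : ℕ} (G : Graph (Fin n)) (M I : Subset n) where
  open Equivalence

  X : Subset n
  X = ∁ (M ─ I)

  V′ : Set
  V′ = Σ (Fin n) (_∈ X)

  ∉M⇒∈X : ∀ {u} → u ∉ M → u ∈ X
  ∉M⇒∈X u∉M = x∉p⇒x∈∁p (u∉M ∘ p─q⊆p M I)

  ∈I⇒∈X : ∀ {u} → u ∈ I → u ∈ X
  ∈I⇒∈X u∈I = x∉p⇒x∈∁p (x∈q⇒x∉p─q M I u∈I)

  toX : Fin n → Maybe V′
  toX u with u ∈? X
  ... | yes u∈X = just (u , u∈X)
  ... | no  _   = nothing

  toX-proj₁ : ∀ a → toX (proj₁ a) ≡ just a
  toX-proj₁ (u , u∈X) with u ∈? X
  ... | yes _   = cong just (subset-ext refl)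
  ... | no  u∉X = contradiction u∈X u∉X

  toX-just : ∀ {u a} → toX u ≡ just a → u ≡ proj₁ a
  toX-just {u} toXu≡ with u ∈? X | toXu≡
  ... | yes _ | refl = refl

  toX-injective : ∀ {u v a} → toX u ≡ just a → toX v ≡ just a → u ≡ v
  toX-injective toX≡₁ toX≡₂ = trans (toX-just toX≡₁) (sym (toX-just toX≡₂))

  restrictEdits : List (Fin n × Fin n) → List (V′ × V′)
  restrictEdits = mapPairs toX

  InS-restrict : ∀ S a b → InS (restrictEdits S) a b ⇔ InS S (proj₁ a) (proj₁ b)
  InS-restrict S a b = mk⇔
    (λ i → let _ , _ , i′ , toX≡₁ , toX≡₂ = InS-mapPairs⁻ toX S i
           in subst₂ (InS S) (toX-just toX≡₁) (toX-just toX≡₂) i′)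
    (λ i → InS-mapPairs⁺ toX S i (toX-proj₁ a) (toX-proj₁ b))

  forward : ∀ {k} → YesInstance (E G) k → YesInstance (Induced G X) k
  forward (S , |S|≤k , loopless , tp) =
    restrictEdits S ,
    ≤-trans (length-mapMaybe _ S) |S|≤k ,
    mapPairs-loopless toX S toX-injective loopless ,
    TriviallyPerfect-pullback (Edit-sym (E-sym G)) (Edit-sym (E-sym G)) proj₁ subset-ext
      (λ a b → Edit-cong {R = Induced G X} {R′ = E G} (⇔-id _) (InS-restrict S a b)) tp

  fromOutside : V′ → Maybe (Fin n)
  fromOutside (u , _) with u ∈? M
  ... | yes _ = nothing
  ... | no  _ = just u

  fromOutside-just : ∀ a {u} → fromOutside a ≡ just u → proj₁ a ≡ u × u ∉ M
  fromOutside-just (u , _) from≡ with u ∈? M | from≡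
  ... | no u∉M | refl = refl , u∉M

  fromOutside-injective : ∀ {a b u} → fromOutside a ≡ just u → fromOutside b ≡ just u → a ≡ b
  fromOutside-injective {a} {b} from≡₁ from≡₂ =
    subset-ext (trans (proj₁ (fromOutside-just a from≡₁)) (sym (proj₁ (fromOutside-just b from≡₂))))

  fromOutside-∉M : ∀ {u} (u∈X : u ∈ X) → u ∉ M → fromOutside (u , u∈X) ≡ just u
  fromOutside-∉M {u} _ u∉M with u ∈? M
  ... | yes u∈M = contradiction u∈M u∉M
  ... | no  _   = refl

  liftEdits : List (V′ × V′) → List (Fin n × Fin n)
  liftEdits = mapPairs fromOutside

  module LiftedSolution (S′ : List (V′ × V′)) where

    H : Rel (Fin n)
    H = Edit (E G) (liftEdits S′)

    H′ : Rel V′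
    H′ = Edit (Induced G X) S′

    H-sym : Symmetric H
    H-sym = Edit-sym (E-sym G)

    lifted-∉M : ∀ {u v} → InS (liftEdits S′) u v → u ∉ M
    lifted-∉M i =
      let a , _ , _ , from≡ , _ = InS-mapPairs⁻ fromOutside S′ i in proj₂ (fromOutside-just a from≡)

    InS-lift : ∀ {u v} (u∈X : u ∈ X) (v∈X : v ∈ X) → InS (liftEdits S′) u v → InS S′ (u , u∈X) (v , v∈X)
    InS-lift _ _ i =
      let a , b , i′ , from≡₁ , from≡₂ = InS-mapPairs⁻ fromOutside S′ i
      in subst₂ (InS S′) (subset-ext (proj₁ (fromOutside-just a from≡₁)))
                         (subset-ext (proj₁ (fromOutside-just b from≡₂))) i′

    InS-lift⇔ : ∀ {u v} (u∈X : u ∈ X) (v∈X : v ∈ X) → u ∉ M → v ∉ M →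
      InS (liftEdits S′) u v ⇔ InS S′ (u , u∈X) (v , v∈X)
    InS-lift⇔ u∈X v∈X u∉M v∉M =
      mk⇔ (InS-lift u∈X v∈X)
          (λ i → InS-mapPairs⁺ fromOutside S′ i (fromOutside-∉M u∈X u∉M) (fromOutside-∉M v∈X v∉M))

    H⇔E : ∀ {u v} → u ∈ M → H u v ⇔ E G u v
    H⇔E u∈M = Edit-unedited {R = E G} (λ i → lifted-∉M i u∈M)

    H-isModule : IsModule G M → ∀ {u v w} → u ∈ M → v ∈ M → w ∉ M → H u w → H v w
    H-isModule modM u∈M v∈M w∉M = from (H⇔E v∈M) ∘ proj₁ (modM _ _ _ u∈M v∈M w∉M) ∘ to (H⇔E u∈M)

    Q : Fin n → Set
    Q v = Σ (v ∈ X) λ v∈X → v ∉ M ⊎ Untouched S′ (v , v∈X)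

    H⇔H′ : ∀ {u v} (qu : Q u) (qv : Q v) → H u v ⇔ H′ (u , proj₁ qu) (v , proj₁ qv)
    H⇔H′ (u∈X , inj₂ untouched) (v∈X , _) =
      ⇔-sym (Edit-unedited {R = Induced G X} (untouched _)) ⇔-∘
      Edit-unedited {R = E G} (untouched _ ∘ InS-lift u∈X v∈X)
    H⇔H′ (u∈X , _) (v∈X , inj₂ untouched) =
      ⇔-sym (Edit-unedited {R = Induced G X} (untouched _ ∘ InS-sym)) ⇔-∘
      Edit-unedited {R = E G} (untouched _ ∘ InS-sym ∘ InS-lift u∈X v∈X)
    H⇔H′ (u∈X , inj₁ u∉M) (v∈X , inj₁ v∉M) =
      Edit-cong {R = E G} {R′ = Induced G X} (⇔-id _) (InS-lift⇔ u∈X v∈X u∉M v∉M)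

    H-triviallyPerfect : IsModule G M → TriviallyPerfect (Induced G M) → TriviallyPerfect H′ →
      ∀ {x₁ x₂} → x₁ ∈ M → x₂ ∈ M → Q x₁ → Q x₂ → x₁ ≢ x₂ → ¬ E G x₁ x₂ → TriviallyPerfect H
    H-triviallyPerfect modM tpM tp′ x₁∈M x₂∈M qx₁ qx₂ x₁≢x₂ ¬x₁x₂ =
      TriviallyPerfect-fromModule H-sym (_∈? M) (H-isModule modM) (λ u∉M → ∉M⇒∈X u∉M , inj₁ u∉M)
        x₁∈M x₂∈M qx₁ qx₂ x₁≢x₂ (¬x₁x₂ ∘ to (H⇔E x₁∈M))
        (TriviallyPerfectOn-transfer H-sym (E-sym G) (λ {u} u∈M → u , u∈M) (λ _ _ → cong proj₁)
           (λ u∈M _ → H⇔E u∈M) tpM)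
        (TriviallyPerfectOn-transfer H-sym (Edit-sym (E-sym G)) (λ {u} qu → u , proj₁ qu) (λ _ _ → cong proj₁)
           H⇔H′ tp′)

  backward : ∀ {k} → IsModule G M → TriviallyPerfect (Induced G M) → I ⊆ M → Independent G I →
    ∣ I ∣ ≡ 2 * k + 4 → YesInstance (Induced G X) k → YesInstance (E G) k
  backward {k} modM tpM I⊆M indI ∣I∣≡ (S′ , |S′|≤k , loopless , tp′) =
    let t₁ , t₂ , t₁∈I , t₂∈I , t₁≢t₂ , t₁∉ , t₂∉ = fresh₂ I touched room
    in liftEdits S′ ,
       ≤-trans (length-mapMaybe _ S′) |S′|≤k ,
       mapPairs-loopless fromOutside S′ fromOutside-injective loopless ,
       H-triviallyPerfect modM tpM tp′ (I⊆M t₁∈I) (I⊆M t₂∈I) (untouched t₁∈I t₁∉) (untouched t₂∈I t₂∉)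
         t₁≢t₂ (indI _ _ t₁∈I t₂∈I)
    where
    open LiftedSolution S′
    open ≤-Reasoning

    touched : List (Fin n)
    touched = map proj₁ (ends S′)

    room : suc (length touched) < ∣ I ∣
    room = begin
      2 + length touched  ≡⟨ cong (2 +_) (trans (length-map proj₁ (ends S′)) (length-ends S′)) ⟩
      2 + 2 * length S′   ≤⟨ +-monoʳ-≤ 2 (*-monoʳ-≤ 2 |S′|≤k) ⟩
      2 + 2 * k           ≡⟨ +-comm 2 (2 * k) ⟩
      2 * k + 2           ≤⟨ +-monoʳ-≤ (2 * k) (m≤m+n 2 2) ⟩
      2 * k + 4           ≡⟨ sym ∣I∣≡ ⟩
      ∣ I ∣               ∎

    untouched : ∀ {t} → t ∈ I → t ∉ₗ touched → Q t
    untouched t∈I t∉ = ∈I⇒∈X t∈I , inj₂ (λ _ i → t∉ (∈-map⁺ proj₁ (InS⇒∈-ends i)))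

lemma11 : (n : ℕ) (G : Graph (Fin n)) (k : ℕ) → Reduced G k →
    (M : Subset n) → IsModule G M → TriviallyPerfect (Induced G M) →
    Σ (Subset n) (λ J → J ⊆ M × Independent G J × 2 * k + 5 ≤ ∣ J ∣) →
    (I : Subset n) → I ⊆ M → Independent G I → ∣ I ∣ ≡ 2 * k + 4 →
    YesInstance (E G) k ⇔ YesInstance (Induced G (∁ (M ─ I))) k
lemma11 n G k _ M modM tpM _ I I⊆M indI ∣I∣≡ = mk⇔ forward (backward modM tpM I⊆M indI ∣I∣≡)
  where open Reduction G M I
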